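{- Let $r$ be a complex number and $n\ge1$ an integer. Then, as polynomials in $x$: (i) $d_n^{(r)}(x)=d_n^{(r+1)}(x)-d_{n-2}^{(r+1)}(x)$; (ii) $d_n^{(r+1)}(x)=\sum_{k=0}^{\lfloor n/2\rfloor}d_{n-2k}^{(r)}(x)$; (iii) $(n+1)^2d_{n+1}^{(r)}(x)^2-(n+2r+1)^2d_n^{(r)}(x)^2=4(x-r)(x+1+r)\big(d_n^{(r+1)}(x)^2-d_{n-1}^{(r+1)}(x)^2\big)$; (iv) $(2r+1)\sum_{k=0}^{n-1}(2k+2r+1)d_k^{(r)}(x)^2=n^2d_n^{(r)}(x)^2-4(x-r)(x+1+r)d_{n-1}^{(r+1)}(x)^2$.
   Context: For a complex number (or polynomial) $a$ and integer $k\ge0$, $\binom{a}{k}=a(a-1)\cdots(a-k+1)/k!$. For a parameter $r$ and an integer $n\ge 0$, $d_n^{(r)}(x)=\sum_{k=0}^n\binom{x+r+k}{k}\binom{x-r}{n-k}$, and by convention $d_{ -1}^{(r)}(x)=0$. -}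

module Defs where

open import Level using (Level; _⊔_) renaming (suc to lsuc)
open import Data.Nat using (ℕ; zero; suc)
open import Data.Integer using (ℤ; +_; -[1+_])
open import Algebra.Bundles using (CommutativeRing)

-- A commutative ℚ-algebra: a commutative ring in which every positive
-- integer 1 + n (n : ℕ) has a (specified) inverse.  ℂ and ℂ[x] are examples.
module NatEmbed {c ℓ : Level} (R : CommutativeRing c ℓ) where
  open CommutativeRing R
  ι : ℕ → Carrier
  ι zero    = 0#
  ι (suc n) = 1# + ι n

record QAlgebra (c ℓ : Level) : Set (lsuc (c ⊔ ℓ)) where
  field
    cring : CommutativeRing c ℓ
  open CommutativeRing cring public
  open NatEmbed cring public
  field
    inv   : ℕ → Carrier
    inv-r : ∀ n → ι (suc n) * inv n ≈ 1#

  infixl 6 _−_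
  _−_ : Carrier → Carrier → Carrier
  a − b = a + (- b)

  sq : Carrier → Carrier
  sq a = a * a

  invFact : ℕ → Carrier
  invFact zero    = 1#
  invFact (suc k) = inv k * invFact k

  falling : Carrier → ℕ → Carrier
  falling a zero    = 1#
  falling a (suc k) = falling a k * (a − ι k)

  binom : Carrier → ℕ → Carrier
  binom a k = falling a k * invFact k

  sumTo : ℕ → (ℕ → Carrier) → Carrier
  sumTo zero    f = f 0
  sumTo (suc m) f = sumTo m f + f (suc m)

  sumBelow : ℕ → (ℕ → Carrier) → Carrier
  sumBelow zero    f = 0#
  sumBelow (suc m) f = sumBelow m f + f m

  d : Carrier → ℕ → Carrier → Carrier
  d r n x = sumTo n (λ k → binom (x + r + ι k) k * binom (x − r) (n Data.Nat.∸ k))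

  dz : Carrier → ℤ → Carrier → Carrier
  dz r (+ n)     x = d r n x
  dz r -[1+ _ ]  x = 0#

-- d_n^(r)(x) is the n-th coefficient of A B, where A = (1 − z)^(−x−r−1) and B = (1 + z)^(x−r).
-- Raising r by one divides A B by (1 − z)(1 + z) = 1 − z², which is (i) (coefficientwise it is
-- Pascal's rule), and (ii) inverts (i).  For the Euler operator θ = z d/dz, absorption gives
-- (1 − z) θA = (x + r + 1) z A and (1 + z) θB = (x − r) z B, so
-- (1 − z²) θ(A B) = ((2x + 1) z + (2r + 1) z²) A B, i.e. the three-term recurrence
-- n d_n = (2x + 1) d_(n−1) + (n + 2r − 1) d_(n−2).  Together with (i) it writes (n + 1) d_(n+1)^(r)
-- and (n + 2r + 1) d_n^(r) as a U + b V and b U + a V, where a = 2x + 1, b = 2r + 1,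
-- U = d_n^(r+1) and V = d_(n−1)^(r+1).  Since (a U + b V)² − (b U + a V)² = (a² − b²)(U² − V²) and
-- a² − b² = 4 (x − r)(x + 1 + r), this is (iii); summing (iii) over n gives (iv).

module Submission where

open import Defs
open import Level using (Level)
open import Data.Nat as ℕ using (ℕ; zero; suc; _≥_; _∸_; _/_) renaming (_*_ to _*ℕ_)
import Data.Nat.Properties as ℕ
open import Data.Nat.DivMod using (m/n≡1+[m∸n]/n)
open import Data.Integer as ℤ using (ℤ; +_; -[1+_]; _⊖_)
import Data.Integer.Properties as ℤ
open import Data.Sign as Sign using (Sign)
open import Data.Product using (_×_; _,_)
open import Data.Maybe using (Maybe; just; nothing)
open import Relation.Nullary using (yes; no)
open import Relation.Binary.PropositionalEquality as ≡ using (_≡_)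
open import Algebra.Bundles using (CommutativeRing; Ring)
import Algebra.Solver.Ring.AlmostCommutativeRing as ACR
import Algebra.Solver.Ring as RingSolver

module IntegerCoefficientSolver {c ℓ : Level} (R : CommutativeRing c ℓ) where
  open CommutativeRing R
  open NatEmbed R
  open import Algebra.Properties.Ring ring using (-0#≈0#; -‿involutive; -1*x≈-x)
  open import Algebra.Properties.AbelianGroup +-abelianGroup using (⁻¹-∙-comm)
  open import Algebra.Properties.Semiring.Mult semiring using (×-homo-+; ×1-homo-*) renaming (_×_ to _×′_)
  open import Algebra.Properties.CommutativeSemigroup +-commutativeSemigroup using (x∙yz≈y∙xz)
  open import Algebra.Properties.CommutativeSemigroup *-commutativeSemigroup
    using () renaming (interchange to *-interchange)
  open import Relation.Binary.Reasoning.Setoid setoid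

  ι≡×1# : ∀ n → ι n ≡ n ×′ 1#
  ι≡×1# zero    = ≡.refl
  ι≡×1# (suc n) = ≡.cong (λ a → 1# + a) (ι≡×1# n)

  ι-+ : ∀ m n → ι (m ℕ.+ n) ≈ ι m + ι n
  ι-+ m n rewrite ι≡×1# (m ℕ.+ n) | ι≡×1# m | ι≡×1# n = ×-homo-+ 1# m n

  ι-* : ∀ m n → ι (m ℕ.* n) ≈ ι m * ι n
  ι-* m n rewrite ι≡×1# (m ℕ.* n) | ι≡×1# m | ι≡×1# n = ×1-homo-* m n

  ιℤ : ℤ → Carrier
  ιℤ (+ n)    = ι n
  ιℤ -[1+ n ] = - ι (suc n)

  ιℤ-⊖ : ∀ m n → ιℤ (m ⊖ n) ≈ ι m - ι n
  ιℤ-⊖ m       zero    = sym (trans (+-congˡ -0#≈0#) (+-identityʳ (ι m)))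
  ιℤ-⊖ zero    (suc n) = sym (+-identityˡ _)
  ιℤ-⊖ (suc m) (suc n) rewrite ℤ.[1+m]⊖[1+n]≡m⊖n m n =
    trans (ιℤ-⊖ m n) (sym (cancel (ι m) (ι n)))
    where
    cancel : ∀ a b → (1# + a) - (1# + b) ≈ a - b
    cancel a b = begin
      (1# + a) - (1# + b)       ≈⟨ +-congˡ (⁻¹-∙-comm 1# b) ⟨
      (1# + a) + ((- 1#) - b)   ≈⟨ +-assoc 1# a ((- 1#) - b) ⟩
      1# + (a + ((- 1#) - b))   ≈⟨ +-congˡ (x∙yz≈y∙xz a (- 1#) (- b)) ⟩
      1# + ((- 1#) + (a - b))   ≈⟨ +-assoc 1# (- 1#) (a - b) ⟨
      (1# - 1#) + (a - b)       ≈⟨ +-congʳ (-‿inverseʳ 1#) ⟩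
      0# + (a - b)              ≈⟨ +-identityˡ (a - b) ⟩
      a - b                     ∎

  ιℤ-+ : ∀ i j → ιℤ (i ℤ.+ j) ≈ ιℤ i + ιℤ j
  ιℤ-+ -[1+ m ] -[1+ n ] = begin
    - ι (suc (suc (m ℕ.+ n)))    ≡⟨ ≡.cong (λ k → - ι (suc k)) (ℕ.+-suc m n) ⟨
    - ι (suc m ℕ.+ suc n)        ≈⟨ -‿cong (ι-+ (suc m) (suc n)) ⟩
    - (ι (suc m) + ι (suc n))    ≈⟨ ⁻¹-∙-comm _ _ ⟨
    - ι (suc m) - ι (suc n)      ∎
  ιℤ-+ -[1+ m ] (+ n)    = trans (ιℤ-⊖ n (suc m)) (+-comm _ _)
  ιℤ-+ (+ m)    -[1+ n ] = ιℤ-⊖ m (suc n)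
  ιℤ-+ (+ m)    (+ n)    = ι-+ m n

  ιℤ-neg : ∀ i → ιℤ (ℤ.- i) ≈ - ιℤ i
  ιℤ-neg -[1+ n ]  = sym (-‿involutive _)
  ιℤ-neg (+ zero)  = sym -0#≈0#
  ιℤ-neg (+ suc n) = refl

  ιSign : Sign → Carrier
  ιSign Sign.+ = 1#
  ιSign Sign.- = - 1#

  ιSign-* : ∀ s t → ιSign (s Sign.* t) ≈ ιSign s * ιSign t
  ιSign-* Sign.+ t      = sym (*-identityˡ _)
  ιSign-* Sign.- Sign.+ = sym (*-identityʳ _)
  ιSign-* Sign.- Sign.- = sym (trans (-1*x≈-x (- 1#)) (-‿involutive 1#))

  ιℤ-◃ : ∀ s n → ιℤ (s ℤ.◃ n) ≈ ιSign s * ι n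
  ιℤ-◃ s      zero    = sym (zeroʳ (ιSign s))
  ιℤ-◃ Sign.+ (suc n) = sym (*-identityˡ _)
  ιℤ-◃ Sign.- (suc n) = sym (-1*x≈-x _)

  ιℤ-signAbs : ∀ i → ιℤ i ≈ ιSign (ℤ.sign i) * ι ℤ.∣ i ∣
  ιℤ-signAbs (+ n)    = sym (*-identityˡ _)
  ιℤ-signAbs -[1+ n ] = sym (-1*x≈-x _)

  ιℤ-* : ∀ i j → ιℤ (i ℤ.* j) ≈ ιℤ i * ιℤ j
  ιℤ-* i j = begin
    ιℤ (i ℤ.* j)                          ≈⟨ ιℤ-◃ (s Sign.* t) (m ℕ.* n) ⟩
    ιSign (s Sign.* t) * ι (m ℕ.* n)      ≈⟨ *-cong (ιSign-* s t) (ι-* m n) ⟩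
    (ιSign s * ιSign t) * (ι m * ι n)     ≈⟨ *-interchange _ _ _ _ ⟩
    (ιSign s * ι m) * (ιSign t * ι n)     ≈⟨ *-cong (ιℤ-signAbs i) (ιℤ-signAbs j) ⟨
    ιℤ i * ιℤ j                           ∎
    where
    s = ℤ.sign i ; t = ℤ.sign j ; m = ℤ.∣ i ∣ ; n = ℤ.∣ j ∣

  private
    homomorphism : Ring.rawRing ℤ.+-*-ring ACR.-Raw-AlmostCommutative⟶ ACR.fromCommutativeRing R
    homomorphism = record
      { ⟦_⟧ = ιℤ ; +-homo = ιℤ-+ ; *-homo = ιℤ-* ; -‿homo = ιℤ-neg
      ; 0-homo = refl ; 1-homo = +-identityʳ 1# }

    ιℤ-≟ : ∀ i j → Maybe (ιℤ i ≈ ιℤ j)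
    ιℤ-≟ i j with i ℤ.≟ j
    ... | yes ≡.refl = just refl
    ... | no _       = nothing

  open RingSolver (Ring.rawRing ℤ.+-*-ring) (ACR.fromCommutativeRing R) homomorphism ιℤ-≟ public

  -- κ k evaluates to ι k, so numerals such as ι 2 in goals are matched by the solver; one evaluates
  -- to 1# itself, whereas con (+ 1) would evaluate to ι 1 = 1# + 0#.
  one : ∀ {n} → Polynomial n
  one = con (+ 0) :^ 0

  κ : ∀ {n} → ℕ → Polynomial n
  κ k = con (+ k)

module _ {c ℓ : Level} (A : QAlgebra c ℓ) where
  open QAlgebra A
  open IntegerCoefficientSolver cring
  open import Algebra.Properties.Ring ring using (-‿distribˡ-*; -0#≈0#)
  open import Algebra.Properties.AbelianGroup +-abelianGroup using (⁻¹-∙-comm)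
  open import Algebra.Properties.CommutativeSemigroup +-commutativeSemigroup
    using () renaming (interchange to +-interchange)
  open import Algebra.Properties.CommutativeSemigroup *-commutativeSemigroup
    using () renaming (x∙yz≈y∙xz to *-x∙yz≈y∙xz)
  open import Relation.Binary.Reasoning.Setoid setoid

  sumTo-cong : ∀ n {f g : ℕ → Carrier} → (∀ k → k ℕ.≤ n → f k ≈ g k) → sumTo n f ≈ sumTo n g
  sumTo-cong zero    f≈g = f≈g 0 ℕ.z≤n
  sumTo-cong (suc n) f≈g =
    +-cong (sumTo-cong n (λ k k≤n → f≈g k (ℕ.m≤n⇒m≤1+n k≤n))) (f≈g (suc n) ℕ.≤-refl)

  sumTo-+ : ∀ n (f g : ℕ → Carrier) → sumTo n (λ k → f k + g k) ≈ sumTo n f + sumTo n g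
  sumTo-+ zero    f g = refl
  sumTo-+ (suc n) f g = trans (+-congʳ (sumTo-+ n f g)) (+-interchange _ _ _ _)

  sumTo-*ˡ : ∀ n a (f : ℕ → Carrier) → sumTo n (λ k → a * f k) ≈ a * sumTo n f
  sumTo-*ˡ zero    a f = refl
  sumTo-*ˡ (suc n) a f = trans (+-congʳ (sumTo-*ˡ n a f)) (sym (distribˡ a _ _))

  sumTo-neg : ∀ n (f : ℕ → Carrier) → sumTo n (λ k → - f k) ≈ - sumTo n f
  sumTo-neg zero    f = refl
  sumTo-neg (suc n) f = trans (+-congʳ (sumTo-neg n f)) (⁻¹-∙-comm _ _)

  sumTo-suc : ∀ n (f : ℕ → Carrier) → sumTo (suc n) f ≈ f 0 + sumTo n (λ k → f (suc k))
  sumTo-suc zero    f = refl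
  sumTo-suc (suc n) f = trans (+-congʳ (sumTo-suc n f)) (+-assoc _ _ _)

  -- A sequence is the coefficient list of a formal power series in z:
  -- shift is multiplication by z, _⋆_ is the product and θ the Euler operator z d/dz.
  Seq : Set c
  Seq = ℕ → Carrier

  shift : Seq → Seq
  shift f zero    = 0#
  shift f (suc n) = f n

  [1+z] : Seq → Seq
  [1+z] f n = f n + shift f n

  [1−z] : Seq → Seq
  [1−z] f n = f n − shift f n

  θ : Seq → Seq
  θ f n = ι n * f n

  infixl 7 _⋆_
  _⋆_ : Seq → Seq → Seq
  (f ⋆ g) n = sumTo n (λ k → f k * g (n ∸ k))

  shift-cong : ∀ {f g : Seq} → (∀ n → f n ≈ g n) → ∀ n → shift f n ≈ shift g n
  shift-cong f≈g zero    = refl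
  shift-cong f≈g (suc n) = f≈g n

  shift-+ : ∀ (f g : Seq) n → shift (λ k → f k + g k) n ≈ shift f n + shift g n
  shift-+ f g zero    = sym (+-identityʳ 0#)
  shift-+ f g (suc n) = refl

  ⋆-cong : ∀ {f f′ g g′ : Seq} → (∀ n → f n ≈ f′ n) → (∀ n → g n ≈ g′ n) →
           ∀ n → (f ⋆ g) n ≈ (f′ ⋆ g′) n
  ⋆-cong f≈f′ g≈g′ n = sumTo-cong n (λ k _ → *-cong (f≈f′ k) (g≈g′ (n ∸ k)))

  ⋆-distribʳ-+ : ∀ (f g h : Seq) n → ((λ k → f k + g k) ⋆ h) n ≈ (f ⋆ h) n + (g ⋆ h) n
  ⋆-distribʳ-+ f g h n = trans (sumTo-cong n (λ k _ → distribʳ _ _ _)) (sumTo-+ n _ _)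

  ⋆-distribˡ-+ : ∀ (f g h : Seq) n → (f ⋆ (λ k → g k + h k)) n ≈ (f ⋆ g) n + (f ⋆ h) n
  ⋆-distribˡ-+ f g h n = trans (sumTo-cong n (λ k _ → distribˡ _ _ _)) (sumTo-+ n _ _)

  ⋆-negˡ : ∀ (f g : Seq) n → ((λ k → - f k) ⋆ g) n ≈ - (f ⋆ g) n
  ⋆-negˡ f g n = trans (sumTo-cong n (λ k _ → sym (-‿distribˡ-* _ _))) (sumTo-neg n _)

  ⋆-scaleˡ : ∀ a (f g : Seq) n → ((λ k → a * f k) ⋆ g) n ≈ a * (f ⋆ g) n
  ⋆-scaleˡ a f g n = trans (sumTo-cong n (λ k _ → *-assoc _ _ _)) (sumTo-*ˡ n a _)

  ⋆-scaleʳ : ∀ a (f g : Seq) n → (f ⋆ (λ k → a * g k)) n ≈ a * (f ⋆ g) n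
  ⋆-scaleʳ a f g n = trans (sumTo-cong n (λ k _ → *-x∙yz≈y∙xz _ _ _)) (sumTo-*ˡ n a _)

  ⋆-shiftˡ : ∀ (f g : Seq) n → (shift f ⋆ g) n ≈ shift (f ⋆ g) n
  ⋆-shiftˡ f g zero    = zeroˡ _
  ⋆-shiftˡ f g (suc n) = begin
    (shift f ⋆ g) (suc n)            ≈⟨ sumTo-suc n _ ⟩
    0# * g (suc n) + (f ⋆ g) n       ≈⟨ +-congʳ (zeroˡ _) ⟩
    0# + (f ⋆ g) n                   ≈⟨ +-identityˡ _ ⟩
    (f ⋆ g) n                        ∎

  ⋆-shiftʳ : ∀ (f g : Seq) n → (f ⋆ shift g) n ≈ shift (f ⋆ g) n
  ⋆-shiftʳ f g zero    = zeroʳ _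
  ⋆-shiftʳ f g (suc n) = begin
    (f ⋆ shift g) (suc n)                        ≈⟨ +-cong (sumTo-cong n shift-suc) (*-congˡ (shift-zero)) ⟩
    (f ⋆ g) n + f (suc n) * 0#                   ≈⟨ +-congˡ (zeroʳ _) ⟩
    (f ⋆ g) n + 0#                               ≈⟨ +-identityʳ _ ⟩
    (f ⋆ g) n                                    ∎
    where
    shift-suc : ∀ k → k ℕ.≤ n → f k * shift g (suc n ∸ k) ≈ f k * g (n ∸ k)
    shift-suc k k≤n = reflexive (≡.cong (λ m → f k * shift g m) (ℕ.+-∸-assoc 1 k≤n))
    shift-zero : shift g (n ∸ n) ≈ 0#
    shift-zero = reflexive (≡.cong (shift g) (ℕ.n∸n≡0 n))

  θ-⋆ : ∀ (f g : Seq) n → θ (f ⋆ g) n ≈ (θ f ⋆ g) n + (f ⋆ θ g) n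
  θ-⋆ f g n = begin
    ι n * (f ⋆ g) n                                                    ≈⟨ sumTo-*ˡ n (ι n) _ ⟨
    sumTo n (λ k → ι n * (f k * g (n ∸ k)))                             ≈⟨ sumTo-cong n split ⟩
    sumTo n (λ k → (ι k * f k) * g (n ∸ k) + f k * (ι (n ∸ k) * g (n ∸ k))) ≈⟨ sumTo-+ n _ _ ⟩
    (θ f ⋆ g) n + (f ⋆ θ g) n                                          ∎
    where
    split : ∀ k → k ℕ.≤ n → ι n * (f k * g (n ∸ k)) ≈ (ι k * f k) * g (n ∸ k) + f k * (ι (n ∸ k) * g (n ∸ k))
    split k k≤n = begin
      ι n * (f k * g (n ∸ k))                    ≡⟨ ≡.cong (λ m → ι m * (f k * g (n ∸ k))) (ℕ.m+[n∸m]≡n k≤n) ⟨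
      ι (k ℕ.+ (n ∸ k)) * (f k * g (n ∸ k))      ≈⟨ *-congʳ (ι-+ k (n ∸ k)) ⟩
      (ι k + ι (n ∸ k)) * (f k * g (n ∸ k))      ≈⟨ solve 4 (λ i j u v → (i :+ j) :* (u :* v) := (i :* u) :* v :+ u :* (j :* v)) refl (ι k) (ι (n ∸ k)) (f k) (g (n ∸ k)) ⟩
      (ι k * f k) * g (n ∸ k) + f k * (ι (n ∸ k) * g (n ∸ k)) ∎

  shift⋆shift : ∀ (f g : Seq) n → (shift f ⋆ shift g) n ≈ shift (shift (f ⋆ g)) n
  shift⋆shift f g n = trans (⋆-shiftˡ f (shift g) n) (shift-cong (⋆-shiftʳ f g) n)

  shift⋆[1+z] : ∀ (f g : Seq) n → (shift f ⋆ [1+z] g) n ≈ [1+z] (shift (f ⋆ g)) n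
  shift⋆[1+z] f g n =
    trans (⋆-distribˡ-+ (shift f) g (shift g) n) (+-cong (⋆-shiftˡ f g n) (shift⋆shift f g n))

  [1−z]⋆shift : ∀ (f g : Seq) n → ([1−z] f ⋆ shift g) n ≈ [1−z] (shift (f ⋆ g)) n
  [1−z]⋆shift f g n = trans (⋆-distribʳ-+ f _ (shift g) n)
    (+-cong (⋆-shiftʳ f g n) (trans (⋆-negˡ (shift f) (shift g) n) (-‿cong (shift⋆shift f g n))))

  [1−z]⋆[1+z] : ∀ (f g : Seq) n → ([1−z] f ⋆ [1+z] g) n ≈ (f ⋆ g) n − shift (shift (f ⋆ g)) n
  [1−z]⋆[1+z] f g n = begin
    ([1−z] f ⋆ [1+z] g) n                                  ≈⟨ ⋆-distribʳ-+ f _ ([1+z] g) n ⟩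
    (f ⋆ [1+z] g) n + ((λ k → - shift f k) ⋆ [1+z] g) n    ≈⟨ +-congˡ (⋆-negˡ (shift f) ([1+z] g) n) ⟩
    (f ⋆ [1+z] g) n − (shift f ⋆ [1+z] g) n                ≈⟨ +-cong (⋆-distribˡ-+ f g (shift g) n) (-‿cong (shift⋆[1+z] f g n)) ⟩
    (h n + (f ⋆ shift g) n) − [1+z] (shift h) n            ≈⟨ +-congʳ (+-congˡ (⋆-shiftʳ f g n)) ⟩
    (h n + shift h n) − (shift h n + shift (shift h) n)
      ≈⟨ solve 3 (λ u v w → (u :+ v) :- (v :+ w) := u :- w) refl (h n) (shift h n) (shift (shift h) n) ⟩
    h n − shift (shift h) n                                ∎
    where h = f ⋆ g

  telescope-by-twos : ∀ {f g : Seq} → (∀ n → f n ≈ g n − shift (shift g) n) →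
                      ∀ n → g n ≈ sumTo (n / 2) (λ k → f (n ∸ 2 ℕ.* k))
  telescope-by-twos {f} {g} f≈ zero       = trans (solve 1 (λ u → u := u :- κ 0) refl (g 0)) (sym (f≈ 0))
  telescope-by-twos {f} {g} f≈ (suc zero) = trans (solve 1 (λ u → u := u :- κ 0) refl (g 1)) (sym (f≈ 1))
  telescope-by-twos {f} {g} f≈ (suc (suc n)) = begin
    g (2 ℕ.+ n)                                              ≈⟨ solve 2 (λ u v → u := (u :- v) :+ v) refl (g (2 ℕ.+ n)) (g n) ⟩
    (g (2 ℕ.+ n) − g n) + g n                                ≈⟨ +-cong (sym (f≈ (2 ℕ.+ n))) (telescope-by-twos f≈ n) ⟩
    f (2 ℕ.+ n) + sumTo (n / 2) (λ k → f (n ∸ 2 ℕ.* k))       ≈⟨ +-congˡ (sumTo-cong (n / 2) (λ k _ → reflexive (≡.cong f (drop-two k)))) ⟨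
    f (2 ℕ.+ n) + sumTo (n / 2) (λ k → f (m ∸ 2 ℕ.* suc k))   ≈⟨ sumTo-suc (n / 2) _ ⟨
    sumTo (suc (n / 2)) (λ k → f (m ∸ 2 ℕ.* k))              ≡⟨ ≡.cong (λ q → sumTo q (λ k → f (m ∸ 2 ℕ.* k))) m/2≡1+n/2 ⟨
    sumTo (m / 2) (λ k → f (m ∸ 2 ℕ.* k))                    ∎
    where
    m = 2 ℕ.+ n
    drop-two : ∀ k → m ∸ 2 ℕ.* suc k ≡ n ∸ 2 ℕ.* k
    drop-two k = ≡.cong (suc n ∸_) (ℕ.+-suc k (k ℕ.+ 0))
    m/2≡1+n/2 : m / 2 ≡ suc (n / 2)
    m/2≡1+n/2 = m/n≡1+[m∸n]/n {m} {2} (ℕ.s≤s (ℕ.s≤s ℕ.z≤n))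

  falling-cong : ∀ {a b} k → a ≈ b → falling a k ≈ falling b k
  falling-cong zero    a≈b = refl
  falling-cong (suc k) a≈b = *-cong (falling-cong k a≈b) (+-congʳ a≈b)

  binom-cong : ∀ {a b} k → a ≈ b → binom a k ≈ binom b k
  binom-cong k a≈b = *-congʳ (falling-cong k a≈b)

  falling-+1#-suc : ∀ a k → falling (a + 1#) (suc k) ≈ (a + 1#) * falling a k
  falling-+1#-suc a zero    = solve 1 (λ a → one :* (a :+ one :- κ 0) := (a :+ one) :* one) refl a
  falling-+1#-suc a (suc k) = trans (*-congʳ (falling-+1#-suc a k))
    (solve 3 (λ a F j → ((a :+ one) :* F) :* (a :+ one :- (one :+ j)) := (a :+ one) :* (F :* (a :- j)))
           refl a (falling a k) (ι k))

  ι-suc-*-binom-suc : ∀ a k → ι (suc k) * binom a (suc k) ≈ falling a (suc k) * invFact k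
  ι-suc-*-binom-suc a k = begin
    ι (suc k) * (F * (inv k * invFact k))
      ≈⟨ solve 4 (λ j i F G → j :* (F :* (i :* G)) := (j :* i) :* (F :* G)) refl (ι (suc k)) (inv k) F (invFact k) ⟩
    (ι (suc k) * inv k) * (F * invFact k)   ≈⟨ *-congʳ (inv-r k) ⟩
    1# * (F * invFact k)                    ≈⟨ *-identityˡ _ ⟩
    F * invFact k                           ∎
    where F = falling a (suc k)

  binom-absorption : ∀ a k → ι (suc k) * binom a (suc k) ≈ (a − ι k) * binom a k
  binom-absorption a k = trans (ι-suc-*-binom-suc a k)
    (solve 3 (λ F u G → (F :* u) :* G := u :* (F :* G)) refl (falling a k) (a − ι k) (invFact k))

  binom-absorption-+1# : ∀ a k → ι (suc k) * binom (a + 1#) (suc k) ≈ (a + 1#) * binom a k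
  binom-absorption-+1# a k = trans (ι-suc-*-binom-suc (a + 1#) k)
    (trans (*-congʳ (falling-+1#-suc a k)) (*-assoc _ _ _))

  binom-pascal : ∀ a k → binom (a + 1#) (suc k) ≈ binom a (suc k) + binom a k
  binom-pascal a k = begin
    falling (a + 1#) (suc k) * (i * G)                      ≈⟨ *-congʳ (falling-+1#-suc a k) ⟩
    ((a + 1#) * F) * (i * G)
      ≈⟨ solve 5 (λ a F G i j → ((a :+ one) :* F) :* (i :* G)
                                  := (F :* (a :- j)) :* (i :* G) :+ (F :* G) :* ((one :+ j) :* i))
               refl a F G i (ι k) ⟩
    (F * (a − ι k)) * (i * G) + (F * G) * (ι (suc k) * i)   ≈⟨ +-congˡ (trans (*-congˡ (inv-r k)) (*-identityʳ _)) ⟩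
    binom a (suc k) + binom a k                             ∎
    where F = falling a k ; G = invFact k ; i = inv k

  -- α c and β e are the coefficient sequences of (1 − z)^(−c−1) and (1 + z)^e.
  α : Carrier → Seq
  α c k = binom (c + ι k) k

  β : Carrier → Seq
  β e k = binom e k

  [1−z]θα : ∀ c n → [1−z] (θ (α c)) n ≈ (c + 1#) * shift (α c) n
  [1−z]θα c zero    = solve 2 (λ c u → κ 0 :* u :- κ 0 := (c :+ one) :* κ 0) refl c (α c 0)
  [1−z]θα c (suc k) = begin
    ι (suc k) * α c (suc k) − ι k * α c k                   ≈⟨ +-congʳ (*-congˡ (binom-cong (suc k) c+ι[1+k]≈)) ⟩
    ι (suc k) * binom (c + ι k + 1#) (suc k) − ι k * α c k  ≈⟨ +-congʳ (binom-absorption-+1# (c + ι k) k) ⟩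
    (c + ι k + 1#) * α c k − ι k * α c k
      ≈⟨ solve 3 (λ c j u → (c :+ j :+ one) :* u :- j :* u := (c :+ one) :* u) refl c (ι k) (α c k) ⟩
    (c + 1#) * α c k                                        ∎
    where
    c+ι[1+k]≈ : c + ι (suc k) ≈ c + ι k + 1#
    c+ι[1+k]≈ = solve 2 (λ c j → c :+ (one :+ j) := c :+ j :+ one) refl c (ι k)

  [1+z]θβ : ∀ e n → [1+z] (θ (β e)) n ≈ e * shift (β e) n
  [1+z]θβ e zero    = solve 2 (λ e u → κ 0 :* u :+ κ 0 := e :* κ 0) refl e (β e 0)
  [1+z]θβ e (suc k) = begin
    ι (suc k) * β e (suc k) + ι k * β e k   ≈⟨ +-congʳ (binom-absorption e k) ⟩
    (e − ι k) * β e k + ι k * β e k         ≈⟨ solve 3 (λ e j u → (e :- j) :* u :+ j :* u := e :* u) refl e (ι k) (β e k) ⟩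
    e * β e k                               ∎

  α-pascal : ∀ {c c′} → c′ ≈ c + 1# → ∀ n → α c n ≈ [1−z] (α c′) n
  α-pascal c′≈ zero    = solve 0 (one :* one := one :* one :- κ 0) refl
  α-pascal {c} {c′} c′≈ (suc k) = begin
    binom a (suc k)                              ≈⟨ solve 2 (λ u v → u := (u :+ v) :- v) refl (binom a (suc k)) (binom a k) ⟩
    binom a (suc k) + binom a k − binom a k      ≈⟨ +-cong (binom-pascal a k) (-‿cong (binom-cong k c′+ι[k]≈)) ⟨
    binom (a + 1#) (suc k) − binom (c′ + ι k) k  ≈⟨ +-congʳ (binom-cong (suc k) a+1≈) ⟩
    [1−z] (α c′) (suc k)                         ∎
    where
    a = c + ι (suc k)
    c′+ι[k]≈ : c′ + ι k ≈ a
    c′+ι[k]≈ = trans (+-congʳ c′≈) (solve 2 (λ c j → c :+ one :+ j := c :+ (one :+ j)) refl c (ι k))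
    a+1≈ : a + 1# ≈ c′ + ι (suc k)
    a+1≈ = sym (trans (+-congʳ c′≈)
      (solve 2 (λ c j → c :+ one :+ (one :+ j) := c :+ (one :+ j) :+ one) refl c (ι k)))

  β-pascal : ∀ {e e′} → e ≈ e′ + 1# → ∀ n → β e n ≈ [1+z] (β e′) n
  β-pascal e≈ zero              = sym (+-identityʳ _)
  β-pascal {e} {e′} e≈ (suc k) = trans (binom-cong (suc k) e≈) (binom-pascal e′ k)

  θ-shift-shift : ∀ (f : Seq) n → θ (shift (shift f)) n ≈ shift (shift (θ f)) n + ι 2 * shift (shift f) n
  θ-shift-shift f zero          = solve 0 (κ 0 :* κ 0 := κ 0 :+ κ 2 :* κ 0) refl
  θ-shift-shift f (suc zero)    = solve 0 (κ 1 :* κ 0 := κ 0 :+ κ 2 :* κ 0) refl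
  θ-shift-shift f (suc (suc n)) =
    solve 2 (λ j u → (one :+ (one :+ j)) :* u := j :* u :+ κ 2 :* u) refl (ι n) (f n)

  sq-swap-difference : ∀ a b u v → sq (a * u + b * v) − sq (b * u + a * v) ≈ (sq a − sq b) * (sq u − sq v)
  sq-swap-difference = solve 4 (λ a b u v →
    (a :* u :+ b :* v) :* (a :* u :+ b :* v) :- (b :* u :+ a :* v) :* (b :* u :+ a :* v)
      := (a :* a :- b :* b) :* (u :* u :- v :* v)) refl

  odd-sq-difference : ∀ x r → sq (ι 2 * x + 1#) − sq (ι 2 * r + 1#) ≈ ι 4 * (x − r) * (x + 1# + r)
  odd-sq-difference = solve 2 (λ x r →
    (κ 2 :* x :+ one) :* (κ 2 :* x :+ one) :- (κ 2 :* r :+ one) :* (κ 2 :* r :+ one)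
      := κ 4 :* (x :- r) :* (x :+ one :+ r)) refl

  module _ (x : Carrier) where

    D : Carrier → Seq
    D r n = d r n x

    d-pascal : ∀ r n → D r n ≈ D (r + 1#) n − shift (shift (D (r + 1#))) n
    d-pascal r n = trans (⋆-cong (α-pascal c′≈) (β-pascal e≈) n) ([1−z]⋆[1+z] _ _ n)
      where
      c′≈ : x + (r + 1#) ≈ x + r + 1#
      c′≈ = sym (+-assoc x r 1#)
      e≈ : x − r ≈ x − (r + 1#) + 1#
      e≈ = solve 2 (λ x r → x :- r := x :- (r :+ one) :+ one) refl x r

    d-θ-recurrence : ∀ s n → θ (D s) n − shift (shift (θ (D s))) n
                             ≈ (ι 2 * x + 1#) * shift (D s) n + (ι 2 * s + 1#) * shift (shift (D s)) n
    d-θ-recurrence s n = begin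
      θ S n − shift (shift (θ S)) n                                    ≈⟨ +-cong (θ-⋆ α′ β′ n) (-‿cong shift²θS≈) ⟩
      (X n + Y n) − (shift (shift X) n + shift (shift Y) n)
        ≈⟨ solve 4 (λ a b c d → (a :+ b) :- (c :+ d) := (a :- c) :+ (b :- d)) refl _ _ _ _ ⟩
      (X n − shift (shift X) n) + (Y n − shift (shift Y) n)            ≈⟨ +-cong [1−z²]X [1−z²]Y ⟩
      (x + s + 1#) * [1+z] (shift S) n + (x − s) * [1−z] (shift S) n
        ≈⟨ solve 4 (λ x s u v → (x :+ s :+ one) :* (u :+ v) :+ (x :- s) :* (u :- v)
                                  := (κ 2 :* x :+ one) :* u :+ (κ 2 :* s :+ one) :* v)
                 refl x s (shift S n) (shift (shift S) n) ⟩
      (ι 2 * x + 1#) * shift S n + (ι 2 * s + 1#) * shift (shift S) n ∎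
      where
      α′ = α (x + s)
      β′ = β (x − s)
      S = D s
      X = θ α′ ⋆ β′
      Y = α′ ⋆ θ β′
      shift²θS≈ : shift (shift (θ S)) n ≈ shift (shift X) n + shift (shift Y) n
      shift²θS≈ = trans (shift-cong (shift-cong (θ-⋆ α′ β′)) n)
                        (trans (shift-cong (shift-+ X Y) n) (shift-+ (shift X) (shift Y) n))
      [1−z²]X : X n − shift (shift X) n ≈ (x + s + 1#) * [1+z] (shift S) n
      [1−z²]X = begin
        X n − shift (shift X) n                               ≈⟨ [1−z]⋆[1+z] (θ α′) β′ n ⟨
        ([1−z] (θ α′) ⋆ [1+z] β′) n                            ≈⟨ ⋆-cong {g = [1+z] β′} ([1−z]θα (x + s)) (λ _ → refl) n ⟩
        ((λ k → (x + s + 1#) * shift α′ k) ⋆ [1+z] β′) n       ≈⟨ ⋆-scaleˡ _ (shift α′) ([1+z] β′) n ⟩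
        (x + s + 1#) * (shift α′ ⋆ [1+z] β′) n                 ≈⟨ *-congˡ (shift⋆[1+z] α′ β′ n) ⟩
        (x + s + 1#) * [1+z] (shift S) n                       ∎
      [1−z²]Y : Y n − shift (shift Y) n ≈ (x − s) * [1−z] (shift S) n
      [1−z²]Y = begin
        Y n − shift (shift Y) n                               ≈⟨ [1−z]⋆[1+z] α′ (θ β′) n ⟨
        ([1−z] α′ ⋆ [1+z] (θ β′)) n                            ≈⟨ ⋆-cong {f = [1−z] α′} (λ _ → refl) ([1+z]θβ (x − s)) n ⟩
        ([1−z] α′ ⋆ (λ k → (x − s) * shift β′ k)) n            ≈⟨ ⋆-scaleʳ _ ([1−z] α′) (shift β′) n ⟩
        (x − s) * ([1−z] α′ ⋆ shift β′) n                      ≈⟨ *-congˡ ([1−z]⋆shift α′ β′ n) ⟩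
        (x − s) * [1−z] (shift S) n                            ∎

    d-recurrence : ∀ s n → ι n * D s n
                           ≈ (ι 2 * x + 1#) * shift (D s) n + (ι n + ι 2 * s − 1#) * shift (shift (D s)) n
    d-recurrence s n = begin
      θ S n
        ≈⟨ solve 2 (λ u v → u := (u :- v) :+ v) refl (θ S n) (shift (shift (θ S)) n) ⟩
      (θ S n − shift (shift (θ S)) n) + shift (shift (θ S)) n         ≈⟨ +-cong (d-θ-recurrence s n) shift²θS≈ ⟩
      (a * T n + (ι 2 * s + 1#) * TT n) + (ι n * TT n − ι 2 * TT n)
        ≈⟨ solve 5 (λ a t u j s → (a :* t :+ (κ 2 :* s :+ one) :* u) :+ (j :* u :- κ 2 :* u)
                                    := a :* t :+ (j :+ κ 2 :* s :- one) :* u)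
                 refl a (T n) (TT n) (ι n) s ⟩
      a * T n + (ι n + ι 2 * s − 1#) * TT n                          ∎
      where
      S = D s
      T = shift S
      TT = shift (shift S)
      a = ι 2 * x + 1#
      shift²θS≈ : shift (shift (θ S)) n ≈ ι n * TT n − ι 2 * TT n
      shift²θS≈ = trans (solve 2 (λ w t → w := (w :+ t) :- t) refl (shift (shift (θ S)) n) (ι 2 * TT n))
                        (+-congʳ (sym (θ-shift-shift S n)))

    θd-via-d[r+1] : ∀ r n → ι n * D r n
                            ≈ (ι 2 * x + 1#) * shift (D (r + 1#)) n + (ι 2 * r + 1#) * shift (shift (D (r + 1#))) n
    θd-via-d[r+1] r n = begin
      ι n * D r n              ≈⟨ *-congˡ (d-pascal r n) ⟩
      ι n * (E n − TT n)       ≈⟨ solve 3 (λ j e u → j :* (e :- u) := j :* e :- j :* u) refl (ι n) (E n) (TT n) ⟩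
      ι n * E n − ι n * TT n   ≈⟨ +-congʳ (d-recurrence (r + 1#) n) ⟩
      a * T n + (ι n + ι 2 * (r + 1#) − 1#) * TT n − ι n * TT n
        ≈⟨ solve 5 (λ a t u j r → a :* t :+ (j :+ κ 2 :* (r :+ one) :- one) :* u :- j :* u
                                    := a :* t :+ (κ 2 :* r :+ one) :* u)
                 refl a (T n) (TT n) (ι n) r ⟩
      a * T n + (ι 2 * r + 1#) * TT n ∎
      where
      E = D (r + 1#)
      T = shift E
      TT = shift (shift E)
      a = ι 2 * x + 1#

    [θ+2r+1]d-via-d[r+1] : ∀ r n → (ι n + ι 2 * r + 1#) * D r n
                                   ≈ (ι 2 * r + 1#) * D (r + 1#) n + (ι 2 * x + 1#) * shift (D (r + 1#)) n
    [θ+2r+1]d-via-d[r+1] r n = begin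
      w * D r n                                  ≈⟨ *-congˡ (d-pascal r n) ⟩
      w * (E n − TT n)
        ≈⟨ solve 4 (λ j r e u → (j :+ κ 2 :* r :+ one) :* (e :- u)
                                  := (κ 2 :* r :+ one) :* e :+ (j :* e :- (j :+ κ 2 :* r :+ one) :* u))
                 refl (ι n) r (E n) (TT n) ⟩
      b * E n + (ι n * E n − w * TT n)           ≈⟨ +-congˡ (+-congʳ (d-recurrence (r + 1#) n)) ⟩
      b * E n + (a * T n + (ι n + ι 2 * (r + 1#) − 1#) * TT n − w * TT n)
        ≈⟨ +-congˡ (solve 5 (λ a t u j r → a :* t :+ (j :+ κ 2 :* (r :+ one) :- one) :* u
                                             :- (j :+ κ 2 :* r :+ one) :* u := a :* t)
                          refl a (T n) (TT n) (ι n) r) ⟩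
      b * E n + a * T n                          ∎
      where
      E = D (r + 1#)
      T = shift E
      TT = shift (shift E)
      a = ι 2 * x + 1#
      b = ι 2 * r + 1#
      w = ι n + ι 2 * r + 1#

    d-squares : ∀ r n → sq (ι (suc n)) * sq (D r (suc n)) − sq (ι n + ι 2 * r + 1#) * sq (D r n)
                        ≈ ι 4 * (x − r) * (x + 1# + r) * (sq (D (r + 1#) n) − sq (shift (D (r + 1#)) n))
    d-squares r n = begin
      sq (ι (suc n)) * sq (D r (suc n)) − sq w * sq (D r n)
        ≈⟨ solve 4 (λ u p v q → (u :* u) :* (p :* p) :- (v :* v) :* (q :* q)
                                  := (u :* p) :* (u :* p) :- (v :* q) :* (v :* q))
                 refl (ι (suc n)) (D r (suc n)) w (D r n) ⟩
      sq (ι (suc n) * D r (suc n)) − sq (w * D r n)         ≈⟨ +-cong (*-cong lower lower) (-‿cong (*-cong upper upper)) ⟩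
      sq (a * E n + b * T n) − sq (b * E n + a * T n)       ≈⟨ sq-swap-difference a b (E n) (T n) ⟩
      (sq a − sq b) * (sq (E n) − sq (T n))                 ≈⟨ *-congʳ (odd-sq-difference x r) ⟩
      ι 4 * (x − r) * (x + 1# + r) * (sq (E n) − sq (T n))  ∎
      where
      E = D (r + 1#)
      T = shift E
      a = ι 2 * x + 1#
      b = ι 2 * r + 1#
      w = ι n + ι 2 * r + 1#
      lower = θd-via-d[r+1] r (suc n)
      upper = [θ+2r+1]d-via-d[r+1] r n

    d-weighted-sum : ∀ r n → (ι 2 * r + 1#) * sumBelow n (λ k → (ι 2 * ι k + ι 2 * r + 1#) * sq (D r k))
                             ≈ sq (ι n) * sq (D r n) − ι 4 * (x − r) * (x + 1# + r) * sq (shift (D (r + 1#)) n)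
    d-weighted-sum r zero    =
      solve 3 (λ r p k → (κ 2 :* r :+ one) :* κ 0 := (κ 0 :* κ 0) :* (p :* p) :- k :* (κ 0 :* κ 0))
            refl r (D r 0) (ι 4 * (x − r) * (x + 1# + r))
    d-weighted-sum r (suc n) = begin
      b * (sumBelow n F + F n)                          ≈⟨ distribˡ b _ _ ⟩
      b * sumBelow n F + b * F n                        ≈⟨ +-congʳ (d-weighted-sum r n) ⟩
      (sq (ι n) * sq (D r n) − K * sq (T n)) + b * F n
        ≈⟨ solve 5 (λ r j p k t → ((j :* j) :* (p :* p) :- k :* (t :* t))
                                      :+ (κ 2 :* r :+ one) :* ((κ 2 :* j :+ κ 2 :* r :+ one) :* (p :* p))
                                    := (j :+ κ 2 :* r :+ one) :* (j :+ κ 2 :* r :+ one) :* (p :* p) :- k :* (t :* t))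
                 refl r (ι n) (D r n) K (T n) ⟩
      sq w * sq (D r n) − K * sq (T n)                  ≈⟨ +-congʳ squares ⟩
      (U − K * (sq (E n) − sq (T n))) − K * sq (T n)
        ≈⟨ solve 4 (λ u k e t → (u :- k :* (e :- t)) :- k :* t := u :- k :* e) refl U K (sq (E n)) (sq (T n)) ⟩
      U − K * sq (E n)                                  ∎
      where
      E = D (r + 1#)
      T = shift E
      b = ι 2 * r + 1#
      w = ι n + ι 2 * r + 1#
      F = λ k → (ι 2 * ι k + ι 2 * r + 1#) * sq (D r k)
      K = ι 4 * (x − r) * (x + 1# + r)
      U = sq (ι (suc n)) * sq (D r (suc n))
      squares : sq w * sq (D r n) ≈ U − K * (sq (E n) − sq (T n))
      squares = trans (solve 2 (λ u v → v := u :- (u :- v)) refl U (sq w * sq (D r n)))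
                      (+-congˡ (-‿cong (d-squares r n)))

    dz-⊖2 : ∀ s n → dz s (n ⊖ 2) x ≡ shift (shift (D s)) n
    dz-⊖2 s zero          = ≡.refl
    dz-⊖2 s (suc zero)    = ≡.refl
    dz-⊖2 s (suc (suc n)) = ≡.cong (λ i → dz s i x)
      (≡.trans (ℤ.[1+m]⊖[1+n]≡m⊖n (suc n) 1) (ℤ.[1+m]⊖[1+n]≡m⊖n n 0))

theorem2p4 : ∀ {c ℓ : Level} (A : QAlgebra c ℓ) → let open QAlgebra A in
    ∀ (r x : Carrier) (n : ℕ) → n ≥ 1 →
      (d r n x ≈ d (r + 1#) n x − dz (r + 1#) (n ⊖ 2) x)
    × (d (r + 1#) n x ≈ sumTo (n / 2) (λ k → d r (n ∸ (2 *ℕ k)) x))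
    × (sq (ι (suc n)) * sq (d r (suc n) x) − sq (ι n + ι 2 * r + 1#) * sq (d r n x)
        ≈ ι 4 * (x − r) * (x + 1# + r) * (sq (d (r + 1#) n x) − sq (d (r + 1#) (n ∸ 1) x)))
    × ((ι 2 * r + 1#) * sumBelow n (λ k → (ι 2 * ι k + ι 2 * r + 1#) * sq (d r k x))
        ≈ sq (ι n) * sq (d r n x) − ι 4 * (x − r) * (x + 1# + r) * sq (d (r + 1#) (n ∸ 1) x))
theorem2p4 A r x n@(suc _) _ =
    trans (d-pascal A x r n) (+-congˡ (-‿cong (reflexive (≡.sym (dz-⊖2 A x (r + 1#) n)))))
  , telescope-by-twos A (d-pascal A x r) n
  , d-squares A x r n
  , d-weighted-sum A x r n
  where open QAlgebra A
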